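{- Let $G=(V,E)$ be a graph whose vertex set is partitioned into safe and unsafe vertices, and let $x$ be a safe vertex of $G$ that is a cut-vertex of $G$. Let $V_1$ be the vertex set of one connected component of $G[V\setminus\{x\}]$ and let $V_2=V\setminus (V_1\cup \{x\})$. Let $E'\subseteq E$ be arbitrary, and for $i\in\{1,2\}$ let $E'_i$ be the set of edges of $E'$ having both endpoints in $V_i\cup\{x\}$. Then $E'$ is a feasible FVC solution for $G$ if and only if, for each $i\in\{1,2\}$, $E'_i$ is a feasible FVC solution for $G_i:=G[V_i\cup\{x\}]$ (where each vertex of $G_i$ keeps its safe/unsafe status from $G$).
   Context: An instance of the problem consists of a graph $G=(V,E)$ together with a partition of $V$ into safe and unsafe vertices. A set $F\subseteq E$ is a feasible FVC solution for $G$ if the graph $(V,F)$ is connected and no unsafe vertex is a cut-vertex of $(V,F)$ (a cut-vertex of a connected graph is a vertex whose removal disconnects it). -}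

module Defs where

open import Data.Nat using (ℕ)
open import Data.Fin using (Fin; _≟_)
open import Data.Bool using (Bool; true; false; T; not; _∧_; _∨_)
open import Data.Product using (_×_; Σ; ∃-syntax)
open import Relation.Nullary using (¬_; Dec; yes; no)
open import Relation.Nullary.Decidable using (⌊_⌋)
open import Relation.Binary.PropositionalEquality using (_≡_)

VSet : ℕ → Set
VSet n = Fin n → Bool

-- An edge set is a Boolean relation; edge {u,v} present iff F u v = true.
-- (Symmetry / irreflexivity is imposed as hypotheses where needed.)
ESet : ℕ → Set
ESet n = Fin n → Fin n → Bool

module _ {n : ℕ} where

  Symmetric : ESet n → Set
  Symmetric F = ∀ u v → T (F u v) → T (F v u)

  Irreflexive : ESet n → Set
  Irreflexive F = ∀ v → ¬ T (F v v)

  _⊆ᴱ_ : ESet n → ESet n → Set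
  F ⊆ᴱ F' = ∀ u v → T (F u v) → T (F' u v)

  _⊆ⱽ_ : VSet n → VSet n → Set
  S ⊆ⱽ S' = ∀ v → T (S v) → T (S' v)

  ⟦_⟧ : Fin n → VSet n
  ⟦ x ⟧ v = ⌊ v ≟ x ⌋

  _minus_ : VSet n → Fin n → VSet n
  (S minus x) v = S v ∧ not ⌊ v ≟ x ⌋

  data Walk (S : VSet n) (F : ESet n) : Fin n → Fin n → Set where
    here : ∀ {u} → T (S u) → Walk S F u u
    step : ∀ {u v w} → T (S u) → T (F u v) → Walk S F v w → Walk S F u w

  Connected : VSet n → ESet n → Set
  Connected S F = ∀ u v → T (S u) → T (S v) → Walk S F u v

  IsCutVertex : VSet n → ESet n → Fin n → Set
  IsCutVertex S F v = Connected S F × T (S v) × ¬ Connected (S minus v) F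

  IsComponent : VSet n → ESet n → VSet n → Set
  IsComponent S F W =
    W ⊆ⱽ S × (∃[ w ] T (W w)) × Connected W F ×
    (∀ (W' : VSet n) → W ⊆ⱽ W' → W' ⊆ⱽ S → Connected W' F → W' ⊆ⱽ W)

  FeasibleFVC : (safe : VSet n) → VSet n → ESet n → Set
  FeasibleFVC safe S F =
    Connected S F × (∀ v → T (S v) → safe v ≡ false → ¬ IsCutVertex S F v)

  allV : VSet n
  allV _ = true

  _∪ⱽ_ : VSet n → VSet n → VSet n
  (A ∪ⱽ B) v = A v ∨ B v

  compl : VSet n → VSet n
  compl A v = not (A v)

  restrictE : ESet n → VSet n → ESet n
  restrictE F A u v = F u v ∧ A u ∧ A v

{-# OPTIONS --safe #-}
-- Both U₁ and U₂ are separated by x: every edge leaving them starts at x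
-- (for U₁ by maximality of the component V₁, for U₂ by symmetry). A walk of
-- (V, E') that starts in such a set stays inside it until it meets x, so
-- connectivity of (V, E') and of (V ∖ v, E') passes to U and U ∖ v with the
-- restricted edges; hence feasibility passes to the two pieces. Conversely
-- U₁ ∪ U₂ = V and U₁ ∩ U₂ = {x}, so walks to x in the pieces glue; an unsafe
-- v differs from the safe x and lies in exactly one piece Uᵢ, and Uᵢ ∖ v
-- together with the other piece still covers V ∖ v through x.
module Submission where

open import Defs
open import Data.Nat using (ℕ)
open import Data.Fin using (Fin; _≟_)
open import Data.Bool using (true; false; T; not; _∧_; _∨_)
open import Data.Bool.Properties using (T-∧; T-∨)
open import Data.Unit using (tt)
open import Data.Sum using (_⊎_; inj₁; inj₂; swap) renaming (map to ⊎-map)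
open import Data.Product using (_×_; _,_; proj₁; proj₂)
open import Function.Base using (_∘_)
open import Function.Bundles using (_⇔_; mk⇔; Equivalence)
open import Relation.Nullary using (¬_; yes; no; contradiction)
open import Relation.Nullary.Decidable
  using (⌊_⌋; T?; toWitness; fromWitness; toWitnessFalse; fromWitnessFalse)
open import Relation.Binary.PropositionalEquality using (_≡_; _≢_; refl; sym; subst)

open Equivalence using (to; from)

T-not : ∀ {b} → T (not b) ⇔ (¬ T b)
T-not {true}  = mk⇔ (λ ()) (λ ¬t → ¬t tt)
T-not {false} = mk⇔ (λ _ ()) (λ _ → tt)

∧-intro : ∀ {p q} → T p → T q → T (p ∧ q)
∧-intro tp tq = from T-∧ (tp , tq)

∨-introˡ : ∀ {p q} → T p → T (p ∨ q)
∨-introˡ tp = from T-∨ (inj₁ tp)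

∨-introʳ : ∀ {p q} → T q → T (p ∨ q)
∨-introʳ {p} tq = from (T-∨ {p}) (inj₂ tq)

module _ {n : ℕ} where

  private variable
    S S' U W A B : VSet n
    F F' : ESet n
    a b u v w x : Fin n

  ∈⟦⟧-self : T (⟦ x ⟧ x)
  ∈⟦⟧-self = fromWitness refl

  ∈∪⟦⟧-elim : ∀ {p} → T (p ∨ ⌊ a ≟ x ⌋) → T p ⊎ a ≡ x
  ∈∪⟦⟧-elim {p = p} t with to (T-∨ {p}) t
  ... | inj₁ tp = inj₁ tp
  ... | inj₂ a≡x = inj₂ (toWitness a≡x)

  restrictE-⊆ : restrictE F U ⊆ᴱ F
  restrictE-⊆ {F = F} a b t = proj₁ (to (T-∧ {F a b}) t)

  restrictE-symmetric : Symmetric F → Symmetric (restrictE F U)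
  restrictE-symmetric {F = F} {U = U} symF a b t with to (T-∧ {F a b}) t
  ... | f , Uab with to (T-∧ {U a}) Uab
  ...   | Ua , Ub = ∧-intro (symF a b f) (∧-intro Ub Ua)

  walk-source : Walk S F u v → T (S u)
  walk-source (here Su)     = Su
  walk-source (step Su _ _) = Su

  _++ʷ_ : Walk S F u v → Walk S F v w → Walk S F u w
  here _       ++ʷ q = q
  step Su f p  ++ʷ q = step Su f (p ++ʷ q)

  walk-reverse : Symmetric F → Walk S F u v → Walk S F v u
  walk-reverse symF (here Su) = here Su
  walk-reverse symF (step {u = u} {v = v} Su f p) =
    walk-reverse symF p ++ʷ step (walk-source p) (symF u v f) (here Su)

  walk-mono : S ⊆ⱽ S' → F ⊆ᴱ F' → Walk S F u v → Walk S' F' u v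
  walk-mono S⊆S' F⊆F' (here Su)     = here (S⊆S' _ Su)
  walk-mono S⊆S' F⊆F' (step Su f p) = step (S⊆S' _ Su) (F⊆F' _ _ f) (walk-mono S⊆S' F⊆F' p)

  connected-monoᴱ : F ⊆ᴱ F' → Connected S F → Connected S F'
  connected-monoᴱ F⊆F' conn u v Su Sv = walk-mono (λ _ Sa → Sa) F⊆F' (conn u v Su Sv)

  connected-via-hub : Symmetric F → (∀ u → T (S u) → Walk S F u x) → Connected S F
  connected-via-hub symF toHub u v Su Sv = toHub u Su ++ʷ walk-reverse symF (toHub v Sv)

  SeparatedBy : Fin n → ESet n → VSet n → Set
  SeparatedBy x F U = ∀ a b → T (U a) → a ≢ x → T (F a b) → T (U b)

  separatedBy-monoᴱ : F ⊆ᴱ F' → SeparatedBy x F' U → SeparatedBy x F U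
  separatedBy-monoᴱ F⊆F' sep a b Ua a≢x f = sep a b Ua a≢x (F⊆F' a b f)

  confine-walk : SeparatedBy x F U → (∀ a → T (S a) → T (U a) → T (W a)) → T (U u) →
    Walk S F u v → Walk W (restrictE F U) u v ⊎ Walk W (restrictE F U) u x
  confine-walk {u = u} sep S∩U⊆W Uu (here Su) = inj₁ (here (S∩U⊆W u Su Uu))
  confine-walk {x = x} {F = F} {U = U} {u = u} sep S∩U⊆W Uu (step {v = u′} Su f p) with u ≟ x
  ... | yes refl = inj₂ (here (S∩U⊆W u Su Uu))
  ... | no u≢x   = ⊎-map (step Wu e) (step Wu e) (confine-walk sep S∩U⊆W Uu′ p)
    where
    Uu′ = sep u u′ Uu u≢x f
    Wu  = S∩U⊆W u Su Uu
    e : T (restrictE F U u u′)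
    e = ∧-intro f (∧-intro Uu Uu′)

  restrictE-connected : Symmetric F → SeparatedBy x F U →
    W ⊆ⱽ S → W ⊆ⱽ U → (∀ a → T (S a) → T (U a) → T (W a)) →
    Connected S F → Connected W (restrictE F U)
  restrictE-connected {U = U} symF sep W⊆S W⊆U S∩U⊆W conn u v Wu Wv
    with confine-walk sep S∩U⊆W (W⊆U u Wu) (conn u v (W⊆S u Wu) (W⊆S v Wv))
       | confine-walk sep S∩U⊆W (W⊆U v Wv) (conn v u (W⊆S v Wv) (W⊆S u Wu))
  ... | inj₁ u⇝v | _         = u⇝v
  ... | inj₂ _   | inj₁ v⇝u  = walk-reverse (restrictE-symmetric {U = U} symF) v⇝u
  ... | inj₂ u⇝x | inj₂ v⇝x  = u⇝x ++ʷ walk-reverse (restrictE-symmetric {U = U} symF) v⇝x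

  connected-∪ : Symmetric F → Connected A F → Connected B F → A ⊆ⱽ S → B ⊆ⱽ S →
    T (A x) → T (B x) → (∀ a → T (S a) → T (A a) ⊎ T (B a)) → Connected S F
  connected-∪ {F = F} {S = S} {x = x} symF connA connB A⊆S B⊆S Ax Bx S⊆A∪B =
    connected-via-hub symF toHub
    where
    toHub : ∀ u → T (S u) → Walk S F u x
    toHub u Su with S⊆A∪B u Su
    ... | inj₁ Au = walk-mono A⊆S (λ _ _ f → f) (connA u x Au Ax)
    ... | inj₂ Bu = walk-mono B⊆S (λ _ _ f → f) (connB u x Bu Bx)

  component-absorbs : Symmetric F → IsComponent S F W →
    T (W a) → T (F a b) → T (S b) → T (W b)
  component-absorbs {F = F} {S = S} {W = W} {a = a} {b = b}
    symF (W⊆S , _ , connW , maximal) Wa f Sb =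
    maximal W′ W⊆W′ W′⊆S (connected-via-hub symF toHub) b b∈W′
    where
    W′ : VSet n
    W′ = W ∪ⱽ ⟦ b ⟧

    W⊆W′ : W ⊆ⱽ W′
    W⊆W′ _ = ∨-introˡ

    b∈W′ : T (W′ b)
    b∈W′ = ∨-introʳ {W b} ∈⟦⟧-self

    W′⊆S : W′ ⊆ⱽ S
    W′⊆S c W′c with ∈∪⟦⟧-elim {p = W c} W′c
    ... | inj₁ Wc   = W⊆S c Wc
    ... | inj₂ refl = Sb

    toHub : ∀ c → T (W′ c) → Walk W′ F c a
    toHub c W′c with ∈∪⟦⟧-elim {p = W c} W′c
    ... | inj₁ Wc   = walk-mono W⊆W′ (λ _ _ e → e) (connW c a Wc Wa)
    ... | inj₂ refl = step b∈W′ (symF a b f) (here (W⊆W′ a Wa))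

  component-separatedBy : Symmetric F → IsComponent (allV minus x) F W →
    SeparatedBy x F (W ∪ⱽ ⟦ x ⟧)
  component-separatedBy {x = x} {W = W} symF comp a b Ua a≢x f
    with ∈∪⟦⟧-elim {p = W a} Ua
  ... | inj₂ a≡x = contradiction a≡x a≢x
  ... | inj₁ Wa with b ≟ x
  ...   | yes _   = ∨-introʳ {W b} tt
  ...   | no b≢x  = ∨-introˡ (component-absorbs symF comp Wa f (fromWitnessFalse b≢x))

  complement-separatedBy : Symmetric F → SeparatedBy x F U →
    SeparatedBy x F (compl U ∪ⱽ ⟦ x ⟧)
  complement-separatedBy {x = x} {U = U} symF sep a b U′a a≢x f with b ≟ x
  ... | yes _  = ∨-introʳ {not (U b)} tt
  ... | no b≢x = ∨-introˡ (from T-not (λ Ub → ¬Ua (sep b a Ub b≢x (symF a b f))))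
    where
    ¬Ua : ¬ T (U a)
    ¬Ua with ∈∪⟦⟧-elim {p = not (U a)} U′a
    ... | inj₁ ¬Ua′ = to T-not ¬Ua′
    ... | inj₂ a≡x  = contradiction a≡x a≢x

  complement-covers : ∀ a → T (U a) ⊎ T ((compl U ∪ⱽ ⟦ x ⟧) a)
  complement-covers {U = U} a with T? (U a)
  ... | yes Ua = inj₁ Ua
  ... | no ¬Ua = inj₂ (∨-introˡ (from T-not ¬Ua))

  complement-overlap : T (U a) → T ((compl U ∪ⱽ ⟦ x ⟧) a) → a ≡ x
  complement-overlap {U = U} {a = a} Ua U′a with ∈∪⟦⟧-elim {p = not (U a)} U′a
  ... | inj₁ ¬Ua = contradiction Ua (to T-not ¬Ua)
  ... | inj₂ a≡x = a≡x

  cutVertex-of-restriction : Symmetric F → SeparatedBy x F U → Connected allV F →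
    IsCutVertex U (restrictE F U) v → IsCutVertex allV F v
  cutVertex-of-restriction {F = F} {U = U} {v = v} symF sep conn (_ , _ , ¬connU−v) =
    conn , tt ,
    λ conn−v → ¬connU−v (restrictE-connected symF sep U−v⊆V−v U−v⊆U V−v∩U⊆U−v conn−v)
    where
    U−v⊆V−v : (U minus v) ⊆ⱽ (allV minus v)
    U−v⊆V−v a t = proj₂ (to (T-∧ {U a}) t)

    U−v⊆U : (U minus v) ⊆ⱽ U
    U−v⊆U a t = proj₁ (to (T-∧ {U a}) t)

    V−v∩U⊆U−v : ∀ a → T ((allV minus v) a) → T (U a) → T ((U minus v) a)
    V−v∩U⊆U−v a a≢v Ua = ∧-intro Ua a≢v

  feasible-restrict : ∀ {safe} → Symmetric F → SeparatedBy x F U →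
    FeasibleFVC safe allV F → FeasibleFVC safe U (restrictE F U)
  feasible-restrict symF sep (conn , noCut) =
    restrictE-connected symF sep (λ _ _ → tt) (λ _ Ua → Ua) (λ _ _ Ua → Ua) conn ,
    λ v Uv unsafe cut → noCut v tt unsafe (cutVertex-of-restriction symF sep conn cut)

  connected-glue : Symmetric F → (∀ a → T (A a) ⊎ T (B a)) → T (A x) → T (B x) →
    Connected A (restrictE F A) → Connected B (restrictE F B) → Connected allV F
  connected-glue {A = A} {B = B} symF cover Ax Bx connA connB =
    connected-∪ symF (connected-monoᴱ (restrictE-⊆ {U = A}) connA)
      (connected-monoᴱ (restrictE-⊆ {U = B}) connB)
      (λ _ _ → tt) (λ _ _ → tt) Ax Bx (λ a _ → cover a)

  cutVertex-of-part : Symmetric F → (∀ a → T (A a) ⊎ T (B a)) → T (A x) → T (B x) →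
    x ≢ v → T (A v) → ¬ T (B v) → Connected A (restrictE F A) → Connected B (restrictE F B) →
    IsCutVertex allV F v → IsCutVertex A (restrictE F A) v
  cutVertex-of-part {F = F} {A = A} {B = B} {x = x} {v = v}
    symF cover Ax Bx x≢v Av ¬Bv connA connB (_ , _ , ¬conn−v) =
    connA , Av , λ connA−v →
      ¬conn−v (connected-∪ symF (connected-monoᴱ (restrictE-⊆ {U = A}) connA−v)
                 (connected-monoᴱ (restrictE-⊆ {U = B}) connB) A−v⊆V−v B⊆V−v
                 (∧-intro Ax (fromWitnessFalse x≢v)) Bx V−v⊆A−v∪B)
    where
    A−v⊆V−v : (A minus v) ⊆ⱽ (allV minus v)
    A−v⊆V−v a t = proj₂ (to (T-∧ {A a}) t)

    B⊆V−v : B ⊆ⱽ (allV minus v)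
    B⊆V−v a Ba = fromWitnessFalse (λ { refl → ¬Bv Ba })

    V−v⊆A−v∪B : ∀ a → T ((allV minus v) a) → T ((A minus v) a) ⊎ T (B a)
    V−v⊆A−v∪B a a≢v = ⊎-map (λ Aa → ∧-intro Aa a≢v) (λ Ba → Ba) (cover a)

  feasible-glue : ∀ {safe} → Symmetric F →
    (∀ a → T (A a) ⊎ T (B a)) → (∀ {a} → T (A a) → T (B a) → a ≡ x) →
    T (A x) → T (B x) → T (safe x) →
    FeasibleFVC safe A (restrictE F A) → FeasibleFVC safe B (restrictE F B) →
    FeasibleFVC safe allV F
  feasible-glue {F = F} {x = x} {safe = safe}
    symF cover A∩B⊆x Ax Bx safeX (connA , noCutA) (connB , noCutB) =
    connected-glue symF cover Ax Bx connA connB , noCut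
    where
    x≢unsafe : safe v ≡ false → x ≢ v
    x≢unsafe unsafe refl = subst T unsafe safeX

    noCut : ∀ v → T (allV v) → safe v ≡ false → ¬ IsCutVertex allV F v
    noCut v _ unsafe cut with cover v
    ... | inj₁ Av = noCutA v Av unsafe
      (cutVertex-of-part symF cover Ax Bx x≢v Av (x≢v ∘ sym ∘ A∩B⊆x Av) connA connB cut)
      where x≢v = x≢unsafe unsafe
    ... | inj₂ Bv = noCutB v Bv unsafe
      (cutVertex-of-part symF (swap ∘ cover) Bx Ax x≢v Bv (λ Av → x≢v (sym (A∩B⊆x Av Bv)))
         connB connA cut)
      where x≢v = x≢unsafe unsafe

mainTheorem1 : (n : ℕ) (E : ESet n) → Symmetric E → Irreflexive E →
    (safe : VSet n) (x : Fin n) → T (safe x) → IsCutVertex allV E x →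
    (V₁ : VSet n) → IsComponent (allV minus x) E V₁ →
    (E' : ESet n) → Symmetric E' → E' ⊆ᴱ E →
    let V₂ = compl (V₁ ∪ⱽ ⟦ x ⟧)
        U₁ = V₁ ∪ⱽ ⟦ x ⟧
        U₂ = V₂ ∪ⱽ ⟦ x ⟧
    in FeasibleFVC safe allV E' ⇔
       (FeasibleFVC safe U₁ (restrictE E' U₁) × FeasibleFVC safe U₂ (restrictE E' U₂))
mainTheorem1 n E symE _ safe x safeX _ V₁ comp E' symE' E'⊆E =
  mk⇔ (λ feasible → feasible-restrict symE' sep₁ feasible ,
                    feasible-restrict symE' sep₂ feasible)
      (λ (feasible₁ , feasible₂) →
        feasible-glue symE' complement-covers (complement-overlap {U = U₁})
          (∨-introʳ {V₁ x} ∈⟦⟧-self) (∨-introʳ {not (U₁ x)} ∈⟦⟧-self) safeX feasible₁ feasible₂)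
  where
  U₁ : VSet n
  U₁ = V₁ ∪ⱽ ⟦ x ⟧

  sepE₁ : SeparatedBy x E U₁
  sepE₁ = component-separatedBy symE comp

  sep₁ : SeparatedBy x E' U₁
  sep₁ = separatedBy-monoᴱ E'⊆E sepE₁

  sep₂ : SeparatedBy x E' (compl U₁ ∪ⱽ ⟦ x ⟧)
  sep₂ = separatedBy-monoᴱ E'⊆E (complement-separatedBy symE sepE₁)
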